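{- Let $q\geq 2$ and $n\geq 2$ be integers and let $S$ be an orientable sequence of order $n$ over $\mathbb{Z}_q$. Then the period of $S$ is at most $(q^n - q^{\lceil n/2\rceil} - q^{\lceil (n-1)/2\rceil} + q)/2$ if $q$ is odd, and at most $(q^n - q^{\lceil n/2\rceil} - q)/2$ if $q$ is even. Further, if $q$ is odd and $n\geq 6$, then the period of $S$ is at most $(q^n - 2q^{n/2} - q^{(n-2)/2} + 2q)/2$ if $n$ is even, and at most $(q^n - q^{(n+1)/2} - 2q^{(n-1)/2} + q + q^2)/2$ if $n$ is odd.
   Context: A periodic sequence $S=(s_i)$ over $\mathbb{Z}_q$ with (least) period $m$ has $n$-tuples $\mathbf{s}_n(i)=(s_i,\dots,s_{i+n-1})$. For $\mathbf{u}=(u_0,\dots,u_{n-1})$ let $\mathbf{u}^R=(u_{n-1},\dots,u_0)$. $S$ is an $n$-window sequence if $\mathbf{s}_n(i)=\mathbf{s}_n(j)$ implies $i\equiv j\pmod m$, and an orientable sequence of order $n$ if it is an $n$-window sequence with $\mathbf{s}_n(i)\neq\mathbf{s}_n(j)^R$ for all $i,j$. -}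

module Defs where

open import Data.Nat using (ℕ; zero; suc; _+_; _*_; _<_; _≤_; _%_)
open import Data.Fin using (Fin; toℕ)
open import Data.Vec using (Vec; tabulate; reverse)
open import Relation.Binary.PropositionalEquality using (_≡_)
open import Data.Product using (_×_; ∃)
open import Data.Sum using (_⊎_)
open import Data.Empty using (⊥)

Seq : ℕ → Set
Seq q = ℕ → Fin q

IsPeriod : ∀ {q} → Seq q → ℕ → Set
IsPeriod s p = (0 < p) × (∀ i → s (i + p) ≡ s i)

LeastPeriod : ∀ {q} → Seq q → ℕ → Set
LeastPeriod s m = IsPeriod s m × (∀ p → IsPeriod s p → m ≤ p)

window : ∀ {q} → Seq q → (n i : ℕ) → Vec (Fin q) n
window s n i = tabulate (λ k → s (i + toℕ k))

CongMod : (m i j : ℕ) → Set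
CongMod m i j = (∃ λ k → i ≡ j + k * m) ⊎ (∃ λ k → j ≡ i + k * m)

IsWindowSeq : ∀ {q} → Seq q → (n m : ℕ) → Set
IsWindowSeq s n m = ∀ i j → window s n i ≡ window s n j → CongMod m i j

IsOrientable : ∀ {q} → Seq q → (n m : ℕ) → Set
IsOrientable s n m =
  LeastPeriod s m × IsWindowSeq s n m
  × (∀ i j → window s n i ≡ reverse (window s n j) → ⊥)

-- View the windows of length n as edges of the de Bruijn graph on words of length n - 1; one period
-- of S is a closed walk through m distinct edges. Orientability makes the m windows, their m
-- reverses and the q ^ ⌈ n /2⌉ palindromes pairwise distinct edges, and every further
-- non-palindromic edge that is unused together with its reverse (a free edge) lowers the bound by one.
-- At a palindromic vertex v the edges v x and x v are reverses of each other, so the walk uses at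
-- most one of them for each letter x; as it enters v as often as it leaves v, it uses an even number
-- of these q pairs. For odd q some pair is therefore unused, and v x is free unless v is constant
-- (the q constant vertices give the + q). For even q the constant vertex c…c has its pair x = c
-- unused, hence a second one. For odd q the in-edges x v can be added as well: an out-edge of one
-- palindrome is the in-edge of another only if the latter is 2-periodic, and constant when n is odd.
module Submission where

open import Defs
open import Data.Nat using (ℕ; _+_; _*_; _^_; _≤_; _%_; ⌈_/2⌉; ⌊_/2⌋; _∸_)
open import Data.Fin using (Fin)
open import Data.Product using (_×_)
open import Relation.Binary.PropositionalEquality using (_≡_)

open import Data.Empty using (⊥; ⊥-elim)
open import Data.Fin using (toℕ; inject₁; fromℕ; punchIn) renaming (zero to fzero; suc to fsuc; _≟_ to _≟ᶠ_)
open import Data.Fin.Properties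
  using (+↔⊎; injective⇒≤; any?; toℕ-injective; toℕ<n; toℕ-inject₁; toℕ-fromℕ; suc-injective; punchInᵢ≢i; 0≢1+n)
open import Data.Nat using (zero; suc; _<_; _≟_; z≤n; s≤s)
open import Data.Nat.Properties
  using ( +-0-commutativeMonoid; 1+n≢0; +-comm; +-assoc; +-suc; +-identityʳ; *-comm; m+n≡0⇒m≡0; m+n≡0⇒n≡0
        ; ≤-reflexive; ≤-trans; <⇒≱; m≤m+n; m≤n+m; m≤m*n; +-cancelʳ-≤; +-monoˡ-≤; +-monoʳ-≤; *-monoˡ-≤
        ; module ≤-Reasoning )
open import Data.Nat.Tactic.RingSolver using (solve-∀)
open import Data.Product using (∃; _,_; proj₁; proj₂; swap)
open import Data.Sum using (_⊎_; inj₁; inj₂; [_,_]′)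
open import Data.Sum.Function.Propositional using (_⊎-↔_)
open import Data.Sum.Properties using (inj₁-injective; inj₂-injective)
open import Data.Vec using (Vec; []; _∷_; _∷ʳ_; reverse; replicate; head; tail; tabulate)
open import Data.Vec.Properties
  using ( reverse-∷; reverse-involutive; reverse-reverse; reverse-injective; ∷-injective; ∷-injectiveˡ
        ; ∷-injectiveʳ; ∷ʳ-injective; ∷ʳ-injectiveˡ; tabulate-cong; ≡-dec )
open import Data.Vec.Recursive using (Fin[m^n]↔Fin[m]^n)
open import Data.Vec.Recursive.Properties using (↔Vec)
open import Function using (_∘_; _↔_; Injective; Injection)
open import Function.Construct.Composition using (_↔-∘_)
open import Function.Properties.Inverse using (↔-refl; ↔-sym; ↔⇒↣)
open import Level using (0ℓ)
open import Relation.Binary using (DecidableEquality)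
open import Relation.Binary.PropositionalEquality
  using (_≢_; refl; sym; trans; cong; cong₂; subst; subst₂; module ≡-Reasoning)
open import Relation.Nullary using (¬_; Dec; yes; no; ¬?)
open import Relation.Nullary.Decidable using (_×-dec_)
open import Relation.Unary using (Pred; Decidable)

open import Algebra.Properties.CommutativeMonoid.Sum +-0-commutativeMonoid
  using (sum; sum-syntax; ∑-comm; ∑-distrib-+; sum-cong-≗; sum-remove; sum-init-last; sum-replicate-zero)

Fin+↔⊎ : ∀ {a b} {X Y : Set} → Fin a ↔ X → Fin b ↔ Y → Fin (a + b) ↔ (X ⊎ Y)
Fin+↔⊎ a↔X b↔Y = (a↔X ⊎-↔ b↔Y) ↔-∘ +↔⊎

Fin^↔Vec : ∀ q j → Fin (q ^ j) ↔ Vec (Fin q) j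
Fin^↔Vec q j = ↔Vec j ↔-∘ Fin[m^n]↔Fin[m]^n q j

↔-injective⇒≤ : ∀ {a b} {X Y : Set} → Fin a ↔ X → Fin b ↔ Y → {f : X → Y} → Injective _≡_ _≡_ f → a ≤ b
↔-injective⇒≤ a↔X b↔Y f-injective =
  injective⇒≤ (Injection.injective (↔⇒↣ a↔X) ∘ f-injective ∘ Injection.injective (↔⇒↣ (↔-sym b↔Y)))

module _ {X Y Z : Set} {f : X → Z} {g : Y → Z} where

  [,]-injective : Injective _≡_ _≡_ f → Injective _≡_ _≡_ g → (∀ x y → f x ≢ g y) → Injective _≡_ _≡_ [ f , g ]′
  [,]-injective f-inj g-inj disjoint {inj₁ x} {inj₁ x′} eq = cong inj₁ (f-inj eq)
  [,]-injective f-inj g-inj disjoint {inj₁ x} {inj₂ y}  eq = ⊥-elim (disjoint x y eq)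
  [,]-injective f-inj g-inj disjoint {inj₂ y} {inj₁ x}  eq = ⊥-elim (disjoint x y (sym eq))
  [,]-injective f-inj g-inj disjoint {inj₂ y} {inj₂ y′} eq = cong inj₂ (g-inj eq)

module _ {X E S : Set} {C : Pred X 0ℓ} (C? : Decidable C) (f : X → E) (g : X → S) where

  branch : X → E ⊎ S
  branch x with C? x
  ... | yes _ = inj₂ (g x)
  ... | no _  = inj₁ (f x)

  branch-injective : Injective _≡_ _≡_ f → (∀ {x y} → C x → C y → g x ≡ g y → x ≡ y) → Injective _≡_ _≡_ branch
  branch-injective f-inj g-inj {x} {y} eq with C? x | C? y
  ... | yes cx | yes cy = g-inj cx cy (inj₂-injective eq)
  ... | no _   | no _   = f-inj (inj₁-injective eq)

  branch-inj₁ : ∀ {P : E → Set} → (∀ {x} → ¬ C x → P (f x)) → ∀ {x e} → branch x ≡ inj₁ e → P e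
  branch-inj₁ P-f {x} eq with C? x
  branch-inj₁ P-f {x} refl | no ¬cx = P-f ¬cx

𝟙 : {P : Set} → Dec P → ℕ
𝟙 (yes _) = 1
𝟙 (no _)  = 0

𝟙-yes : ∀ {P : Set} (P? : Dec P) → P → 𝟙 P? ≡ 1
𝟙-yes (yes _) p = refl
𝟙-yes (no ¬p) p = ⊥-elim (¬p p)

𝟙-no : ∀ {P : Set} (P? : Dec P) → ¬ P → 𝟙 P? ≡ 0
𝟙-no (yes p) ¬p = ⊥-elim (¬p p)
𝟙-no (no _)  ¬p = refl

𝟙-cong : ∀ {P Q : Set} (P? : Dec P) (Q? : Dec Q) → (P → Q) → (Q → P) → 𝟙 P? ≡ 𝟙 Q?
𝟙-cong (yes p) Q? P→Q Q→P = sym (𝟙-yes Q? (P→Q p))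
𝟙-cong (no ¬p) Q? P→Q Q→P = sym (𝟙-no Q? (¬p ∘ Q→P))

𝟙≡0⇒¬ : ∀ {P : Set} (P? : Dec P) → 𝟙 P? ≡ 0 → ¬ P
𝟙≡0⇒¬ (no ¬p) _ = ¬p

≤1∧≢0⇒≡1 : ∀ {a} → a ≤ 1 → a ≢ 0 → a ≡ 1
≤1∧≢0⇒≡1 z≤n       a≢0 = ⊥-elim (a≢0 refl)
≤1∧≢0⇒≡1 (s≤s z≤n) _   = refl

exclusive-≤1⇒+≤1 : ∀ {a b} → a ≤ 1 → b ≤ 1 → (a ≢ 0 → b ≢ 0 → ⊥) → a + b ≤ 1
exclusive-≤1⇒+≤1 z≤n       b≤1       _         = b≤1
exclusive-≤1⇒+≤1 (s≤s z≤n) z≤n       _         = s≤s z≤n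
exclusive-≤1⇒+≤1 (s≤s z≤n) (s≤s z≤n) exclusive = ⊥-elim (exclusive (λ ()) (λ ()))

-- suc (suc n) % 2 reduces to n % 2; this and the parity recursions below rely on it.
[n+n]%2≡0 : ∀ n → (n + n) % 2 ≡ 0
[n+n]%2≡0 zero    = refl
[n+n]%2≡0 (suc n) = trans (cong (λ z → suc z % 2) (+-suc n n)) ([n+n]%2≡0 n)

[1+n+n]%2≡1 : ∀ n → suc (n + n) % 2 ≡ 1
[1+n+n]%2≡1 zero    = refl
[1+n+n]%2≡1 (suc n) = trans (cong (λ z → suc (suc z) % 2) (+-suc n n)) ([1+n+n]%2≡1 n)

sum≡0⇒≡0 : ∀ {n} (f : Fin n → ℕ) → sum f ≡ 0 → ∀ i → f i ≡ 0
sum≡0⇒≡0 f eq fzero    = m+n≡0⇒m≡0 (f fzero) eq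
sum≡0⇒≡0 f eq (fsuc i) = sum≡0⇒≡0 (f ∘ fsuc) (m+n≡0⇒n≡0 (f fzero) eq) i

sum-ones : ∀ {n} (f : Fin n → ℕ) → (∀ i → f i ≡ 1) → sum f ≡ n
sum-ones {zero}  f ones = refl
sum-ones {suc n} f ones = cong₂ _+_ (ones fzero) (sum-ones (f ∘ fsuc) (ones ∘ fsuc))

sum-ones-except : ∀ {n} (f : Fin n → ℕ) c → f c ≡ 0 → (∀ i → i ≢ c → f i ≡ 1) → suc (sum f) ≡ n
sum-ones-except {suc n} f c fc≡0 ones = cong suc (begin
  sum f                               ≡⟨ sum-remove {i = c} f ⟩
  f c + ∑[ j < n ] f (punchIn c j)    ≡⟨ cong₂ _+_ fc≡0 (sum-ones (f ∘ punchIn c) (λ j → ones _ (punchInᵢ≢i c j))) ⟩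
  n                                   ∎)
  where open ≡-Reasoning

∑-rotate : ∀ m (f : ℕ → ℕ) → f m ≡ f 0 → ∑[ i < m ] f (suc (toℕ i)) ≡ ∑[ i < m ] f (toℕ i)
∑-rotate zero    f _       = refl
∑-rotate (suc m) f fm≡f0 = begin
  ∑[ i < suc m ] f (suc (toℕ i))                                   ≡⟨ sum-init-last (λ i → f (suc (toℕ i))) ⟩
  ∑[ i < m ] f (suc (toℕ (inject₁ i))) + f (suc (toℕ (fromℕ m)))
    ≡⟨ cong₂ _+_ (sum-cong-≗ {m} (cong (f ∘ suc) ∘ toℕ-inject₁)) (cong (f ∘ suc) (toℕ-fromℕ m)) ⟩
  rest + f (suc m)                                                 ≡⟨ +-comm rest (f (suc m)) ⟩
  f (suc m) + rest                                                 ≡⟨ cong (_+ rest) fm≡f0 ⟩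
  ∑[ i < suc m ] f (toℕ i)                                         ∎
  where
  open ≡-Reasoning
  rest = ∑[ i < m ] f (suc (toℕ i))

module _ {n} {P : Pred (Fin n) 0ℓ} (P? : Decidable P) where

  ∑𝟙≡0⇒¬ : ∑[ i < n ] 𝟙 (P? i) ≡ 0 → ∀ i → ¬ P i
  ∑𝟙≡0⇒¬ eq i = 𝟙≡0⇒¬ (P? i) (sum≡0⇒≡0 (λ i → 𝟙 (P? i)) eq i)

  ¬⇒∑𝟙≡0 : (∀ i → ¬ P i) → ∑[ i < n ] 𝟙 (P? i) ≡ 0
  ¬⇒∑𝟙≡0 ¬P = trans (sum-cong-≗ (λ i → 𝟙-no (P? i) (¬P i))) (sum-replicate-zero n)

  ∑𝟙≢0⇒∃ : ∑[ i < n ] 𝟙 (P? i) ≢ 0 → ∃ P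
  ∑𝟙≢0⇒∃ ∑≢0 with any? P?
  ... | yes ∃P = ∃P
  ... | no ¬∃P = ⊥-elim (∑≢0 (¬⇒∑𝟙≡0 (λ i p → ¬∃P (i , p))))

∑𝟙≤1 : ∀ {n} {P : Pred (Fin n) 0ℓ} (P? : Decidable P) → (∀ {i j} → P i → P j → i ≡ j) → ∑[ i < n ] 𝟙 (P? i) ≤ 1
∑𝟙≤1 {zero}  P? unique = z≤n
∑𝟙≤1 {suc n} P? unique with P? fzero
... | yes p₀ = ≤-reflexive (cong suc (¬⇒∑𝟙≡0 (P? ∘ fsuc) (λ i p → 0≢1+n (unique p₀ p))))
... | no _   = ∑𝟙≤1 (P? ∘ fsuc) (λ p p′ → suc-injective (unique p p′))

∑𝟙[y≟x]≡1 : ∀ {n} (y : Fin n) → ∑[ x < n ] 𝟙 (y ≟ᶠ x) ≡ 1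
∑𝟙[y≟x]≡1 {suc n} y = begin
  ∑[ x < suc n ] 𝟙 (y ≟ᶠ x)                     ≡⟨ sum-remove {i = y} (λ x → 𝟙 (y ≟ᶠ x)) ⟩
  𝟙 (y ≟ᶠ y) + ∑[ j < n ] 𝟙 (y ≟ᶠ punchIn y j)  ≡⟨ cong₂ _+_ (𝟙-yes (y ≟ᶠ y) refl)
                                                      (¬⇒∑𝟙≡0 (λ j → y ≟ᶠ punchIn y j) (λ j → punchInᵢ≢i y j ∘ sym)) ⟩
  1                                             ∎
  where open ≡-Reasoning

module _ {B C : Set} {q} (_≟B_ : DecidableEquality B) (_≟C_ : DecidableEquality C) (pair : B → Fin q → C)
         (pair-injective : ∀ {u v x y} → pair u x ≡ pair v y → u ≡ v × x ≡ y) where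

  ∑𝟙-pair : ∀ u y v → ∑[ x < q ] 𝟙 (pair u y ≟C pair v x) ≡ 𝟙 (u ≟B v)
  ∑𝟙-pair u y v with u ≟B v
  ... | no u≢v   = ¬⇒∑𝟙≡0 (λ x → pair u y ≟C pair v x) (λ x → u≢v ∘ proj₁ ∘ pair-injective)
  ... | yes refl = trans
    (sum-cong-≗ {q} (λ x → 𝟙-cong (pair u y ≟C pair u x) (y ≟ᶠ x) (proj₂ ∘ pair-injective) (cong (pair u))))
    (∑𝟙[y≟x]≡1 y)

module _ {q d} (h : Fin q → ℕ) (h≤1 : ∀ x → h x ≤ 1) (∑h≡d+d : ∑[ x < q ] h x ≡ d + d) where

  odd⇒∃-zero : q % 2 ≡ 1 → ∃ λ x → h x ≡ 0
  odd⇒∃-zero q-odd with any? (λ x → h x ≟ 0)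
  ... | yes zero-of-h = zero-of-h
  ... | no ¬zero = ⊥-elim (1+n≢0 (begin
    1              ≡⟨ q-odd ⟨
    q % 2          ≡⟨ cong (_% 2) (trans (sym (sum-ones h ones)) ∑h≡d+d) ⟩
    (d + d) % 2    ≡⟨ [n+n]%2≡0 d ⟩
    0              ∎))
    where
    open ≡-Reasoning
    ones : ∀ x → h x ≡ 1
    ones x = ≤1∧≢0⇒≡1 (h≤1 x) (λ hx≡0 → ¬zero (x , hx≡0))

  even⇒∃-other-zero : q % 2 ≡ 0 → ∀ c → h c ≡ 0 → ∃ λ x → x ≢ c × h x ≡ 0
  even⇒∃-other-zero q-even c hc≡0 with any? (λ x → ¬? (x ≟ᶠ c) ×-dec (h x ≟ 0))
  ... | yes other = other
  ... | no ¬other = ⊥-elim (1+n≢0 (begin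
    1                   ≡⟨ [1+n+n]%2≡1 d ⟨
    suc (d + d) % 2     ≡⟨ cong (_% 2) (trans (cong suc (sym ∑h≡d+d)) (sum-ones-except h c hc≡0 ones)) ⟩
    q % 2               ≡⟨ q-even ⟩
    0                   ∎))
    where
    open ≡-Reasoning
    ones : ∀ x → x ≢ c → h x ≡ 1
    ones x x≢c = ≤1∧≢0⇒≡1 (h≤1 x) (λ hx≡0 → ¬other (x , x≢c , hx≡0))

module _ {A : Set} where

  Palindrome : ∀ {n} → Vec A n → Set
  Palindrome v = reverse v ≡ v

  reverse-∷ʳ : ∀ {n} x (xs : Vec A n) → reverse (xs ∷ʳ x) ≡ x ∷ reverse xs
  reverse-∷ʳ x xs = reverse-reverse (trans (reverse-∷ x (reverse xs)) (cong (_∷ʳ x) (reverse-involutive xs)))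

  replicate-∷ʳ : ∀ n (x : A) → replicate n x ∷ʳ x ≡ x ∷ replicate n x
  replicate-∷ʳ zero    x = refl
  replicate-∷ʳ (suc n) x = cong (x ∷_) (replicate-∷ʳ n x)

  ∷ʳ≡∷⇒replicate : ∀ {n} (v : Vec A n) x → v ∷ʳ x ≡ x ∷ v → v ≡ replicate n x
  ∷ʳ≡∷⇒replicate []      x eq = refl
  ∷ʳ≡∷⇒replicate (a ∷ v) x eq with refl , eq′ ← ∷-injective eq = cong (a ∷_) (∷ʳ≡∷⇒replicate v a eq′)

  palindrome-∷ʳ : ∀ {n} {v : Vec A n} x → Palindrome v → reverse (v ∷ʳ x) ≡ x ∷ v
  palindrome-∷ʳ {v = v} x pal = trans (reverse-∷ʳ x v) (cong (x ∷_) pal)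

  palindrome-∷ : ∀ {n} {v : Vec A n} x → Palindrome v → reverse (x ∷ v) ≡ v ∷ʳ x
  palindrome-∷ {v = v} x pal = trans (reverse-∷ x v) (cong (_∷ʳ x) pal)

  mirror : ∀ n → Vec A ⌈ n /2⌉ → Vec A n
  mirror zero          []       = []
  mirror (suc zero)    (a ∷ []) = a ∷ []
  mirror (suc (suc n)) (a ∷ u)  = a ∷ (mirror n u ∷ʳ a)

  mirror-palindrome : ∀ n u → Palindrome (mirror n u)
  mirror-palindrome zero          []       = refl
  mirror-palindrome (suc zero)    (a ∷ []) = refl
  mirror-palindrome (suc (suc n)) (a ∷ u)  = begin
    reverse (a ∷ (mirror n u ∷ʳ a))   ≡⟨ reverse-∷ a (mirror n u ∷ʳ a) ⟩
    reverse (mirror n u ∷ʳ a) ∷ʳ a    ≡⟨ cong (_∷ʳ a) (palindrome-∷ʳ {v = mirror n u} a (mirror-palindrome n u)) ⟩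
    a ∷ (mirror n u ∷ʳ a)             ∎
    where open ≡-Reasoning

  mirror-injective : ∀ n {u u′} → mirror n u ≡ mirror n u′ → u ≡ u′
  mirror-injective zero          {[]}     {[]}     eq = refl
  mirror-injective (suc zero)    {a ∷ []} {b ∷ []} eq = eq
  mirror-injective (suc (suc n)) {a ∷ u}  {b ∷ u′} eq with refl , eq′ ← ∷-injective eq =
    cong (a ∷_) (mirror-injective n (∷ʳ-injectiveˡ _ _ eq′))

  mirror-replicate : ∀ n (x : A) → mirror n (replicate ⌈ n /2⌉ x) ≡ replicate n x
  mirror-replicate zero          x = refl
  mirror-replicate (suc zero)    x = refl
  mirror-replicate (suc (suc n)) x = cong (x ∷_) (trans (cong (_∷ʳ x) (mirror-replicate n x)) (replicate-∷ʳ n x))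

  palindrome-replicate : ∀ n (x : A) → Palindrome (replicate n x)
  palindrome-replicate n x = subst Palindrome (mirror-replicate n x) (mirror-palindrome n _)

  mirror-∷∷∷ : ∀ j (a b c : A) r → ∃ λ t → mirror (5 + j) (a ∷ b ∷ c ∷ r) ≡ a ∷ b ∷ c ∷ t
  mirror-∷∷∷ zero    a b c [] = _ , refl
  mirror-∷∷∷ (suc j) a b c r  = _ , refl

  -- Reversing both sides, each through its palindrome, identifies v with u ∷ʳ y and x with a.
  palindrome-overlap : ∀ {n} {v : Vec A (suc n)} {a u x y} → Palindrome v → Palindrome (a ∷ u) →
                       v ∷ʳ x ≡ y ∷ a ∷ u → y ∷ a ∷ u ≡ u ∷ʳ y ∷ʳ a
  palindrome-overlap {v = v} {a} {u} {x} {y} pal-v pal-au eq =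
    trans (sym eq) (cong₂ _∷ʳ_ (∷-injectiveʳ reversed) (∷-injectiveˡ reversed))
    where
    reversed : x ∷ v ≡ a ∷ (u ∷ʳ y)
    reversed = begin
      x ∷ v                 ≡⟨ palindrome-∷ʳ x pal-v ⟨
      reverse (v ∷ʳ x)      ≡⟨ cong reverse eq ⟩
      reverse (y ∷ a ∷ u)   ≡⟨ palindrome-∷ y pal-au ⟩
      a ∷ (u ∷ʳ y)          ∎
      where open ≡-Reasoning

  rotation₂-odd : ∀ {n} (u : Vec A n) {a y} → n % 2 ≡ 1 → y ∷ a ∷ u ≡ u ∷ʳ y ∷ʳ a → y ≡ a × u ≡ replicate n a
  rotation₂-odd []          ()
  rotation₂-odd (c ∷ [])    _   refl = refl , refl
  rotation₂-odd (c ∷ d ∷ u) odd eq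
    with refl ← ∷-injectiveˡ eq | refl ← ∷-injectiveˡ (∷-injectiveʳ eq)
    with refl , refl ← rotation₂-odd u odd (∷-injectiveʳ (∷-injectiveʳ eq)) = refl , refl

  overlap⇒replicate : ∀ {n} {v w : Vec A (suc n)} {x y} → n % 2 ≡ 1 → Palindrome v → Palindrome w →
                      v ∷ʳ x ≡ y ∷ w → w ≡ replicate _ (head w)
  overlap⇒replicate {w = a ∷ u} n-odd pal-v pal-w eq =
    cong (a ∷_) (proj₂ (rotation₂-odd u n-odd (palindrome-overlap pal-v pal-w eq)))

  overlap⇒head≡third : ∀ {n} {v : Vec A (3 + n)} {a b c} {t : Vec A n} {x y} → Palindrome v →
                       Palindrome (a ∷ b ∷ c ∷ t) → v ∷ʳ x ≡ y ∷ a ∷ b ∷ c ∷ t → a ≡ c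
  overlap⇒head≡third pal-v pal-w eq = ∷-injectiveˡ (∷-injectiveʳ (palindrome-overlap pal-v pal-w eq))

tabulate-toℕ-∷ʳ : ∀ {A : Set} n (f : ℕ → A) → tabulate {n = suc n} (f ∘ toℕ) ≡ tabulate (f ∘ toℕ) ∷ʳ f n
tabulate-toℕ-∷ʳ zero    f = refl
tabulate-toℕ-∷ʳ (suc n) f = cong (f 0 ∷_) (tabulate-toℕ-∷ʳ n (f ∘ suc))

module _ {q} (s : Seq q) where

  window-∷ʳ : ∀ n i → window s (suc n) i ≡ window s n i ∷ʳ s (i + n)
  window-∷ʳ n i = tabulate-toℕ-∷ʳ n (λ j → s (i + j))

  window-∷ : ∀ n i → window s (suc n) i ≡ s i ∷ window s n (suc i)
  window-∷ n i = cong₂ _∷_ (cong s (+-identityʳ i)) (tabulate-cong (λ j → cong s (+-suc i (toℕ j))))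

  window-periodic : ∀ {m} → (∀ i → s (i + m) ≡ s i) → ∀ n → window s n m ≡ window s n 0
  window-periodic {m} period n = tabulate-cong (λ j → trans (cong s (+-comm m (toℕ j))) (period (toℕ j)))

CongMod-<⇒≡ : ∀ {m i j} → i < m → j < m → CongMod m i j → i ≡ j
CongMod-<⇒≡ {m} i<m j<m (inj₁ (k , i≡j+km)) = below-period k i<m i≡j+km
  where
  below-period : ∀ {i j} k → i < m → i ≡ j + k * m → i ≡ j
  below-period         zero    _   eq   = trans eq (+-identityʳ _)
  below-period {j = j} (suc k) i<m refl = ⊥-elim (<⇒≱ i<m (≤-trans (m≤m+n m (k * m)) (m≤n+m _ j)))
CongMod-<⇒≡ i<m j<m (inj₂ (k , j≡i+km)) = sym (CongMod-<⇒≡ j<m i<m (inj₁ (k , j≡i+km)))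

module OrientableSequence {q k m : ℕ} {s : Seq q} (orientable : IsOrientable s (suc (suc k)) m) where

  Vertex Edge : Set
  Vertex = Vec (Fin q) (suc k)
  Edge   = Vec (Fin q) (suc (suc k))

  infix 4 _≟ᵥ_
  _≟ᵥ_ : ∀ {j} → DecidableEquality (Vec (Fin q) j)
  _≟ᵥ_ = ≡-dec _≟ᶠ_

  vertex : ℕ → Vertex
  vertex = window s (suc k)

  edge : Fin m → Edge
  edge i = window s (suc (suc k)) (toℕ i)

  edge-injective : Injective _≡_ _≡_ edge
  edge-injective {i} {j} eq = toℕ-injective (CongMod-<⇒≡ (toℕ<n i) (toℕ<n j) (proj₁ (proj₂ orientable) _ _ eq))

  edge≢reverse-edge : ∀ i j → edge i ≢ reverse (edge j)
  edge≢reverse-edge i j = proj₂ (proj₂ orientable) (toℕ i) (toℕ j)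

  Used : Edge → Set
  Used e = ∃ λ i → edge i ≡ e

  used⇒reverse-unused : ∀ {e} → Used e → ¬ Used (reverse e)
  used⇒reverse-unused (i , refl) (j , eⱼ) = edge≢reverse-edge j i eⱼ

  palindrome⇒unused : ∀ {e} → Palindrome e → ¬ Used e
  palindrome⇒unused pal used = used⇒reverse-unused used (subst Used (sym pal) used)

  Free : Edge → Set
  Free e = ¬ Used e × ¬ Used (reverse e) × ¬ Palindrome e

  free-reverse : ∀ {e} → Free e → Free (reverse e)
  free-reverse {e} (unused , unused-rev , ¬pal) =
    unused-rev , subst (¬_ ∘ Used) (sym (reverse-involutive e)) unused , ¬pal ∘ reverse-injective

  BothUnused : Vertex → Fin q → Set
  BothUnused v x = ¬ Used (v ∷ʳ x) × ¬ Used (x ∷ v)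

  free-∷ʳ : ∀ {v x} → Palindrome v → v ≢ replicate _ x → BothUnused v x → Free (v ∷ʳ x)
  free-∷ʳ {v} {x} pal v≢xs (unused-out , unused-in) =
    unused-out , subst (¬_ ∘ Used) (sym (palindrome-∷ʳ x pal)) unused-in ,
    λ pal-vx → v≢xs (∷ʳ≡∷⇒replicate v x (trans (sym pal-vx) (palindrome-∷ʳ x pal)))

  free-∷ : ∀ {v x} → Palindrome v → v ≢ replicate _ x → BothUnused v x → Free (x ∷ v)
  free-∷ {x = x} pal v≢xs unused = subst Free (palindrome-∷ʳ x pal) (free-reverse (free-∷ʳ pal v≢xs unused))

  uses : Edge → ℕ
  uses e = ∑[ i < m ] 𝟙 (edge i ≟ᵥ e)

  uses≤1 : ∀ e → uses e ≤ 1
  uses≤1 e = ∑𝟙≤1 (λ i → edge i ≟ᵥ e) (λ eᵢ eⱼ → edge-injective (trans eᵢ (sym eⱼ)))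

  unused⇒uses≡0 : ∀ {e} → ¬ Used e → uses e ≡ 0
  unused⇒uses≡0 {e} unused = ¬⇒∑𝟙≡0 (λ i → edge i ≟ᵥ e) (λ i eq → unused (i , eq))

  uses≡0⇒unused : ∀ {e} → uses e ≡ 0 → ¬ Used e
  uses≡0⇒unused {e} eq (i , eᵢ) = ∑𝟙≡0⇒¬ (λ i → edge i ≟ᵥ e) eq i eᵢ

  uses≢0⇒used : ∀ {e} → uses e ≢ 0 → Used e
  uses≢0⇒used {e} = ∑𝟙≢0⇒∃ (λ i → edge i ≟ᵥ e)

  outdeg indeg : Vertex → ℕ
  outdeg v = ∑[ i < m ] 𝟙 (vertex (toℕ i) ≟ᵥ v)
  indeg  v = ∑[ i < m ] 𝟙 (vertex (suc (toℕ i)) ≟ᵥ v)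

  indeg≡outdeg : ∀ v → indeg v ≡ outdeg v
  indeg≡outdeg v = ∑-rotate m (λ i → 𝟙 (vertex i ≟ᵥ v))
    (cong (λ w → 𝟙 (w ≟ᵥ v)) (window-periodic s (proj₂ (proj₁ (proj₁ orientable))) (suc k)))

  ∑uses-∷ʳ : ∀ v → ∑[ x < q ] uses (v ∷ʳ x) ≡ outdeg v
  ∑uses-∷ʳ v = begin
    ∑[ x < q ] ∑[ i < m ] 𝟙 (edge i ≟ᵥ v ∷ʳ x)   ≡⟨ ∑-comm (λ x i → 𝟙 (edge i ≟ᵥ v ∷ʳ x)) ⟩
    ∑[ i < m ] ∑[ x < q ] 𝟙 (edge i ≟ᵥ v ∷ʳ x)   ≡⟨ sum-cong-≗ {m} (λ i →
      trans (cong (λ e → ∑[ x < q ] 𝟙 (e ≟ᵥ v ∷ʳ x)) (window-∷ʳ s (suc k) (toℕ i)))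
            (∑𝟙-pair _≟ᵥ_ _≟ᵥ_ _∷ʳ_ (∷ʳ-injective _ _) (vertex (toℕ i)) _ v)) ⟩
    outdeg v                                     ∎
    where open ≡-Reasoning

  ∑uses-∷ : ∀ v → ∑[ x < q ] uses (x ∷ v) ≡ indeg v
  ∑uses-∷ v = begin
    ∑[ x < q ] ∑[ i < m ] 𝟙 (edge i ≟ᵥ x ∷ v)    ≡⟨ ∑-comm (λ x i → 𝟙 (edge i ≟ᵥ x ∷ v)) ⟩
    ∑[ i < m ] ∑[ x < q ] 𝟙 (edge i ≟ᵥ x ∷ v)    ≡⟨ sum-cong-≗ {m} (λ i →
      trans (cong (λ e → ∑[ x < q ] 𝟙 (e ≟ᵥ x ∷ v)) (window-∷ s (suc k) (toℕ i)))
            (∑𝟙-pair _≟ᵥ_ _≟ᵥ_ (λ w x → x ∷ w) (swap ∘ ∷-injective) (vertex (suc (toℕ i))) _ v)) ⟩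
    indeg v                                      ∎
    where open ≡-Reasoning

  module _ {v : Vertex} (pal : Palindrome v) where

    load : Fin q → ℕ
    load x = uses (v ∷ʳ x) + uses (x ∷ v)

    ∑load : ∑[ x < q ] load x ≡ outdeg v + outdeg v
    ∑load = begin
      ∑[ x < q ] load x                                    ≡⟨ ∑-distrib-+ (λ x → uses (v ∷ʳ x)) (λ x → uses (x ∷ v)) ⟩
      ∑[ x < q ] uses (v ∷ʳ x) + ∑[ x < q ] uses (x ∷ v)   ≡⟨ cong₂ _+_ (∑uses-∷ʳ v) (trans (∑uses-∷ v) (indeg≡outdeg v)) ⟩
      outdeg v + outdeg v                                  ∎
      where open ≡-Reasoning

    load≤1 : ∀ x → load x ≤ 1
    load≤1 x = exclusive-≤1⇒+≤1 (uses≤1 _) (uses≤1 _) λ out≢0 in≢0 →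
      used⇒reverse-unused (uses≢0⇒used out≢0) (subst Used (sym (palindrome-∷ʳ x pal)) (uses≢0⇒used in≢0))

    load≡0⇒both-unused : ∀ {x} → load x ≡ 0 → BothUnused v x
    load≡0⇒both-unused {x} eq = uses≡0⇒unused (m+n≡0⇒m≡0 _ eq) , uses≡0⇒unused (m+n≡0⇒n≡0 (uses (v ∷ʳ x)) eq)

    both-unused⇒load≡0 : ∀ {x} → BothUnused v x → load x ≡ 0
    both-unused⇒load≡0 (unused-out , unused-in) = cong₂ _+_ (unused⇒uses≡0 unused-out) (unused⇒uses≡0 unused-in)

    odd⇒∃-both-unused : q % 2 ≡ 1 → ∃ (BothUnused v)
    odd⇒∃-both-unused q-odd with x , load≡0 ← odd⇒∃-zero {d = outdeg v} load load≤1 ∑load q-odd =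
      x , load≡0⇒both-unused load≡0

    even⇒∃-other-both-unused : q % 2 ≡ 0 → ∀ {c} → BothUnused v c → ∃ λ x → x ≢ c × BothUnused v x
    even⇒∃-other-both-unused q-even {c} unused
      with x , x≢c , load≡0 ← even⇒∃-other-zero {d = outdeg v} load load≤1 ∑load q-even c (both-unused⇒load≡0 unused) =
      x , x≢c , load≡0⇒both-unused load≡0

  occupied : (Fin m ⊎ Fin m) ⊎ Vec (Fin q) ⌈ suc (suc k) /2⌉ → Edge
  occupied = [ [ edge , reverse ∘ edge ]′ , mirror (suc (suc k)) ]′

  occupied-injective : Injective _≡_ _≡_ occupied
  occupied-injective =
    [,]-injective ([,]-injective edge-injective (edge-injective ∘ reverse-injective) edge≢reverse-edge)
                  (mirror-injective (suc (suc k))) window-not-palindrome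
    where
    window-not-palindrome : ∀ w u → [ edge , reverse ∘ edge ]′ w ≢ mirror (suc (suc k)) u
    window-not-palindrome (inj₁ i) u eq =
      palindrome⇒unused (subst Palindrome (sym eq) (mirror-palindrome _ u)) (i , refl)
    window-not-palindrome (inj₂ i) u eq =
      palindrome⇒unused (subst Palindrome (reverse-reverse eq) (cong reverse (mirror-palindrome _ u))) (i , refl)

  occupied-not-free : ∀ o → ¬ Free (occupied o)
  occupied-not-free (inj₁ (inj₁ i)) (unused , _ , _)     = unused (i , refl)
  occupied-not-free (inj₁ (inj₂ i)) (_ , unused-rev , _) = unused-rev (i , sym (reverse-involutive (edge i)))
  occupied-not-free (inj₂ u)        (_ , _ , ¬pal)       = ¬pal (mirror-palindrome _ u)

  period-bound : ∀ {Rest Slot : Set} {a b} → Fin a ↔ Rest → Fin b ↔ Slot →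
                 (ρ : Rest → Edge ⊎ Slot) → Injective _≡_ _≡_ ρ → (∀ {r e} → ρ r ≡ inj₁ e → Free e) →
                 2 * m + q ^ ⌈ suc (suc k) /2⌉ + a ≤ q ^ suc (suc k) + b
  period-bound {a = a} {b} a↔Rest b↔Slot ρ ρ-injective ρ-free =
    subst (λ z → z + q ^ ⌈ suc (suc k) /2⌉ + a ≤ q ^ suc (suc k) + b) (cong (m +_) (sym (+-identityʳ m)))
      (↔-injective⇒≤ (Fin+↔⊎ (Fin+↔⊎ (Fin+↔⊎ ↔-refl ↔-refl) (Fin^↔Vec q _)) a↔Rest) (Fin+↔⊎ (Fin^↔Vec q _) b↔Slot)
        ([,]-injective (occupied-injective ∘ inj₁-injective) ρ-injective
          (λ o r eq → occupied-not-free o (ρ-free (sym eq)))))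

  Half : Set
  Half = Vec (Fin q) ⌈ suc k /2⌉

  centre : Half → Vertex
  centre = mirror (suc k)

  Constant : Half → Set
  Constant u = u ≡ replicate _ (head u)

  constant? : Decidable Constant
  constant? u = u ≟ᵥ replicate _ (head u)

  constant-head-injective : ∀ {u u′} → Constant u → Constant u′ → head u ≡ head u′ → u ≡ u′
  constant-head-injective c c′ eq = trans c (trans (cong (replicate _) eq) (sym c′))

  centre-replicate⇒constant : ∀ {u x} → centre u ≡ replicate _ x → Constant u
  centre-replicate⇒constant {u} {x} eq = trans u≡xs (cong (replicate _) (sym (cong head u≡xs)))
    where
    u≡xs : u ≡ replicate _ x
    u≡xs = mirror-injective (suc k) (trans eq (sym (mirror-replicate (suc k) x)))

  module OddAlphabet (q-odd : q % 2 ≡ 1) where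

    extension : Half → Fin q
    extension u = proj₁ (odd⇒∃-both-unused (mirror-palindrome (suc k) u) q-odd)

    extension-unused : ∀ u → BothUnused (centre u) (extension u)
    extension-unused u = proj₂ (odd⇒∃-both-unused (mirror-palindrome (suc k) u) q-odd)

    out-edge in-edge : Half → Edge
    out-edge u = centre u ∷ʳ extension u
    in-edge  u = extension u ∷ centre u

    out-edge-injective : Injective _≡_ _≡_ out-edge
    out-edge-injective = mirror-injective (suc k) ∘ ∷ʳ-injectiveˡ _ _

    in-edge-injective : Injective _≡_ _≡_ in-edge
    in-edge-injective = mirror-injective (suc k) ∘ ∷-injectiveʳ

    out-edge-free : ∀ {u} → ¬ Constant u → Free (out-edge u)
    out-edge-free {u} ¬c = free-∷ʳ (mirror-palindrome (suc k) u) (¬c ∘ centre-replicate⇒constant) (extension-unused u)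

    in-edge-free : ∀ {u} → ¬ Constant u → Free (in-edge u)
    in-edge-free {u} ¬c = free-∷ (mirror-palindrome (suc k) u) (¬c ∘ centre-replicate⇒constant) (extension-unused u)

    odd-bound : 2 * m + q ^ ⌈ suc (suc k) /2⌉ + q ^ ⌈ suc k /2⌉ ≤ q ^ suc (suc k) + q
    odd-bound = period-bound (Fin^↔Vec q _) ↔-refl (branch constant? out-edge head)
      (branch-injective constant? out-edge head out-edge-injective constant-head-injective)
      (branch-inj₁ constant? out-edge head out-edge-free)

    module _ {S : Set} {b} (b↔S : Fin b ↔ S) {C : Pred Half 0ℓ} (C? : Decidable C)
             (constant⇒C : ∀ {u} → Constant u → C u)
             (g : Half → S) (g-injective : ∀ {u u′} → C u → C u′ → g u ≡ g u′ → u ≡ u′)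
             (overlap⇒C : ∀ {u u′ x y} → centre u ∷ʳ x ≡ y ∷ centre u′ → C u′) where

      out into : Half → Edge ⊎ (Fin q ⊎ S)
      out  = branch constant? out-edge (inj₁ ∘ head)
      into = branch C? in-edge (inj₂ ∘ g)

      out≢into : ∀ u u′ → out u ≢ into u′
      out≢into u u′ eq with constant? u | C? u′
      out≢into u u′ () | yes _ | yes _
      out≢into u u′ () | yes _ | no _
      out≢into u u′ () | no _  | yes _
      out≢into u u′ eq | no _  | no ¬c′ = ¬c′ (overlap⇒C (inj₁-injective eq))

      in-out-bound : 2 * m + q ^ ⌈ suc (suc k) /2⌉ + (q ^ ⌈ suc k /2⌉ + q ^ ⌈ suc k /2⌉) ≤ q ^ suc (suc k) + (q + b)
      in-out-bound = period-bound (Fin+↔⊎ (Fin^↔Vec q _) (Fin^↔Vec q _)) (Fin+↔⊎ ↔-refl b↔S) [ out , into ]′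
        ([,]-injective (branch-injective constant? out-edge (inj₁ ∘ head) out-edge-injective
                          (λ c c′ → constant-head-injective c c′ ∘ inj₁-injective))
                       (branch-injective C? in-edge (inj₂ ∘ g) in-edge-injective
                          (λ c c′ → g-injective c c′ ∘ inj₂-injective))
                       out≢into)
        λ { {inj₁ u} → branch-inj₁ constant? out-edge (inj₁ ∘ head) {Free} out-edge-free
          ; {inj₂ u} → branch-inj₁ C? in-edge (inj₂ ∘ g) {Free} (in-edge-free ∘ (_∘ constant⇒C)) }

  module EvenAlphabet (q-even : q % 2 ≡ 0) where

    constant-both-unused : ∀ c → BothUnused (replicate _ c) c
    constant-both-unused c =
      palindrome⇒unused (subst Palindrome (sym (replicate-∷ʳ (suc k) c)) (palindrome-replicate _ c)) ,
      palindrome⇒unused (palindrome-replicate _ c)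

    partner : ∀ c → ∃ λ x → x ≢ c × BothUnused (replicate _ c) x
    partner c = even⇒∃-other-both-unused (palindrome-replicate _ c) q-even (constant-both-unused c)

    constant-out-edge : Fin q → Edge ⊎ Fin 0
    constant-out-edge c = inj₁ (replicate _ c ∷ʳ proj₁ (partner c))

    constant-out-edge-free : ∀ {c e} → constant-out-edge c ≡ inj₁ e → Free e
    constant-out-edge-free {c} refl =
      free-∷ʳ (palindrome-replicate _ c) (proj₁ (proj₂ (partner c)) ∘ sym ∘ ∷-injectiveˡ) (proj₂ (proj₂ (partner c)))

    even-bound : 2 * m + q ^ ⌈ suc (suc k) /2⌉ + q ≤ q ^ suc (suc k)
    even-bound = subst (2 * m + q ^ ⌈ suc (suc k) /2⌉ + q ≤_) (+-identityʳ _)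
      (period-bound ↔-refl ↔-refl constant-out-edge (∷-injectiveˡ ∘ ∷ʳ-injectiveˡ _ _ ∘ inj₁-injective)
        constant-out-edge-free)

module _ {q : ℕ} where

  HeadIsThird : ∀ {j} → Vec (Fin q) (3 + j) → Set
  HeadIsThird (a ∷ _ ∷ c ∷ _) = a ≡ c

  headIsThird? : ∀ {j} → Decidable (HeadIsThird {j})
  headIsThird? (a ∷ _ ∷ c ∷ _) = a ≟ᶠ c

  headIsThird-tail-injective : ∀ {j} {u u′ : Vec (Fin q) (3 + j)} → HeadIsThird u → HeadIsThird u′ →
                               tail u ≡ tail u′ → u ≡ u′
  headIsThird-tail-injective {u = _ ∷ _ ∷ _ ∷ _} {_ ∷ _ ∷ _ ∷ _} refl refl refl = refl

odd-order-in-out-bound : ∀ {q k m} {s : Seq q} → IsOrientable s (suc (suc k)) m → q % 2 ≡ 1 → k % 2 ≡ 1 →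
  2 * m + q ^ ⌈ suc (suc k) /2⌉ + (q ^ ⌈ suc k /2⌉ + q ^ ⌈ suc k /2⌉) ≤ q ^ suc (suc k) + (q + q)
odd-order-in-out-bound {k = k} orientable q-odd k-odd =
  in-out-bound ↔-refl constant? (λ c → c) head constant-head-injective
    (λ {u} {u′} eq → centre-replicate⇒constant
       (overlap⇒replicate k-odd (mirror-palindrome (suc k) u) (mirror-palindrome (suc k) u′) eq))
  where
  open OrientableSequence orientable
  open OddAlphabet q-odd

even-order-in-out-bound : ∀ {q j m} {s : Seq q} → IsOrientable s (6 + j) m → q % 2 ≡ 1 →
  2 * m + q ^ ⌈ 6 + j /2⌉ + (q ^ ⌈ 5 + j /2⌉ + q ^ ⌈ 5 + j /2⌉) ≤ q ^ (6 + j) + (q + q ^ (2 + ⌊ j /2⌋))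
even-order-in-out-bound {q} {j} orientable q-odd =
  in-out-bound (Fin^↔Vec q _) headIsThird? constant⇒headIsThird tail headIsThird-tail-injective overlap⇒headIsThird
  where
  open OrientableSequence orientable
  open OddAlphabet q-odd

  constant⇒headIsThird : ∀ {u} → Constant u → HeadIsThird u
  constant⇒headIsThird {_ ∷ _ ∷ _ ∷ _} eq = sym (cong (head ∘ tail ∘ tail) eq)

  overlap⇒headIsThird : ∀ {u u′ x y} → centre u ∷ʳ x ≡ y ∷ centre u′ → HeadIsThird u′
  overlap⇒headIsThird {u} {u′ = a ∷ b ∷ c ∷ r} {y = y} eq with t , centre≡abct ← mirror-∷∷∷ j a b c r =
    overlap⇒head≡third (mirror-palindrome (5 + j) u)
      (subst Palindrome centre≡abct (mirror-palindrome (5 + j) (a ∷ b ∷ c ∷ r))) (trans eq (cong (y ∷_) centre≡abct))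

⌈n/2⌉≡⌊n/2⌋ : ∀ n → n % 2 ≡ 0 → ⌈ n /2⌉ ≡ ⌊ n /2⌋
⌈n/2⌉≡⌊n/2⌋ zero          _      = refl
⌈n/2⌉≡⌊n/2⌋ (suc zero)    ()
⌈n/2⌉≡⌊n/2⌋ (suc (suc n)) n-even = cong suc (⌈n/2⌉≡⌊n/2⌋ n n-even)

⌈n/2⌉≡1+⌊n/2⌋ : ∀ n → n % 2 ≡ 1 → ⌈ n /2⌉ ≡ suc ⌊ n /2⌋
⌈n/2⌉≡1+⌊n/2⌋ zero          ()
⌈n/2⌉≡1+⌊n/2⌋ (suc zero)    _     = refl
⌈n/2⌉≡1+⌊n/2⌋ (suc (suc n)) n-odd = cong suc (⌈n/2⌉≡1+⌊n/2⌋ n n-odd)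

n≤n^2 : ∀ n → n ≤ n ^ 2
n≤n^2 zero    = z≤n
n≤n^2 (suc n) = m≤m*n (suc n) (suc n ^ 1)

even-order-arithmetic : ∀ {m q P X Q} → 2 ≤ q → P ≡ q * X → 2 * m + P + (q * X + q * X) ≤ Q + (q + X) →
                        2 * m + 2 * (q * X) + X ≤ Q + 2 * q
even-order-arithmetic {m} {q} {P} {X} {Q} q≥2 refl bound = +-cancelʳ-≤ (q * X) _ _ (begin
  2 * m + 2 * (q * X) + X + q * X       ≡⟨ regroup m (q * X) X ⟩
  2 * m + q * X + (q * X + q * X) + X   ≤⟨ +-monoˡ-≤ X bound ⟩
  Q + (q + X) + X                       ≡⟨ collect Q q X ⟩
  Q + q + 2 * X                         ≤⟨ +-monoʳ-≤ (Q + q) (*-monoˡ-≤ X q≥2) ⟩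
  Q + q + q * X                         ≤⟨ +-monoˡ-≤ (q * X) (+-monoʳ-≤ Q (m≤m*n q 2)) ⟩
  Q + q * 2 + q * X                     ≡⟨ cong (λ z → Q + z + q * X) (*-comm q 2) ⟩
  Q + 2 * q + q * X                     ∎)
  where
  open ≤-Reasoning
  regroup : ∀ m K X → 2 * m + 2 * K + X + K ≡ 2 * m + K + (K + K) + X
  regroup = solve-∀
  collect : ∀ Q q X → Q + (q + X) + X ≡ Q + q + 2 * X
  collect = solve-∀

odd-order-arithmetic : ∀ {m P H Q q} → 2 * m + P + (H + H) ≤ Q + (q + q) → 2 * m + P + 2 * H ≤ Q + q + q ^ 2
odd-order-arithmetic {m} {P} {H} {Q} {q} bound = begin
  2 * m + P + 2 * H     ≡⟨ cong (λ z → 2 * m + P + (H + z)) (+-identityʳ H) ⟩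
  2 * m + P + (H + H)   ≤⟨ bound ⟩
  Q + (q + q)           ≡⟨ +-assoc Q q q ⟨
  Q + q + q             ≤⟨ +-monoʳ-≤ (Q + q) (n≤n^2 q) ⟩
  Q + q + q ^ 2         ∎
  where open ≤-Reasoning

even-order-bound : ∀ {q n m} {s : Seq q} → IsOrientable s n m → 2 ≤ q → q % 2 ≡ 1 → 6 ≤ n → n % 2 ≡ 0 →
                   2 * m + 2 * q ^ ⌊ n /2⌋ + q ^ ⌊ (n ∸ 2) /2⌋ ≤ q ^ n + 2 * q
even-order-bound {q} {m = m} orientable q≥2 q-odd (s≤s (s≤s (s≤s (s≤s (s≤s (s≤s {n = j} z≤n)))))) j-even =
  even-order-arithmetic {m} {X = q ^ (2 + ⌊ j /2⌋)} {Q = q ^ (6 + j)} q≥2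
    (cong (λ a → q ^ (3 + a)) (⌈n/2⌉≡⌊n/2⌋ j j-even)) (even-order-in-out-bound orientable q-odd)

odd-order-bound : ∀ {q n m} {s : Seq q} → IsOrientable s n m → q % 2 ≡ 1 → 2 ≤ n → n % 2 ≡ 1 →
                  2 * m + q ^ ⌊ (n + 1) /2⌋ + 2 * q ^ ⌊ (n ∸ 1) /2⌋ ≤ q ^ n + q + q ^ 2
odd-order-bound {q} {n} {m} orientable q-odd (s≤s (s≤s {n = k} z≤n)) k-odd =
  odd-order-arithmetic {m} {q ^ ⌊ (n + 1) /2⌋} {q ^ ⌈ k /2⌉} {q ^ n} {q}
  (subst₂ (λ a b → 2 * m + q ^ a + (q ^ b + q ^ b) ≤ q ^ n + (q + q))
          (cong ⌊_/2⌋ (+-comm 1 n)) (sym (⌈n/2⌉≡1+⌊n/2⌋ k k-odd)) (odd-order-in-out-bound orientable q-odd k-odd))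

theorem3 : (q n m : ℕ) → 2 ≤ q → 2 ≤ n → (s : Seq q) → IsOrientable s n m →
    ((q % 2 ≡ 1 → 2 * m + q ^ ⌈ n /2⌉ + q ^ ⌈ (n ∸ 1) /2⌉ ≤ q ^ n + q)
    × (q % 2 ≡ 0 → 2 * m + q ^ ⌈ n /2⌉ + q ≤ q ^ n))
    × (q % 2 ≡ 1 → 6 ≤ n →
        (n % 2 ≡ 0 → 2 * m + 2 * q ^ ⌊ n /2⌋ + q ^ ⌊ (n ∸ 2) /2⌋ ≤ q ^ n + 2 * q)
      × (n % 2 ≡ 1 → 2 * m + q ^ ⌊ (n + 1) /2⌋ + 2 * q ^ ⌊ (n ∸ 1) /2⌋ ≤ q ^ n + q + q ^ 2))
theorem3 q n@(suc (suc _)) m q≥2 n≥2@(s≤s (s≤s z≤n)) s orientable =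
  (OddAlphabet.odd-bound , EvenAlphabet.even-bound) ,
  λ q-odd n≥6 → even-order-bound orientable q≥2 q-odd n≥6 , odd-order-bound orientable q-odd n≥2
  where open OrientableSequence orientable
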